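{- Every SBEP graph $G$ is prism-hamiltonian, i.e., $G\Box K_2$ has a hamiltonian cycle.
   Context: A simple block EP (SBEP) graph is a connected finite simple graph $H$ such that (i) each block of $H$ is either an even cycle or a single edge, and (ii) each vertex of $H$ lies in at most two blocks. The prism $G\Box K_2$ consists of two copies of $G$ with the two copies of each vertex joined by an edge. -}

module Defs where

open import Data.Nat using (ℕ; zero; suc; _≤_; _*_)
open import Data.Nat.DivMod using (_mod_)
open import Data.Fin using (Fin; toℕ)
open import Data.Fin.Subset using (Subset; _∈_; _∉_; _⊆_; _-_)
open import Data.Bool using (Bool; true; false)
open import Data.Product using (Σ; ∃; _×_; _,_)
open import Data.Sum using (_⊎_)
open import Relation.Binary.PropositionalEquality using (_≡_; _≢_)
open import Relation.Nullary using (¬_)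
open import Function.Definitions using (Injective; Surjective)

record Graph : Set where
  field
    n     : ℕ
    adj   : Fin n → Fin n → Bool
    sym   : ∀ u v → adj u v ≡ adj v u
    irrefl : ∀ v → adj v v ≡ false

module _ (G : Graph) where
  open Graph G

  Adj : Fin n → Fin n → Set
  Adj u v = adj u v ≡ true

  data ReachIn (S : Subset n) : Fin n → Fin n → Set where
    here : ∀ {v} → v ∈ S → ReachIn S v v
    step : ∀ {u w v} → u ∈ S → Adj u w → ReachIn S w v → ReachIn S u v

  -- the induced subgraph G[S] is connected (vacuous for empty S)
  ConnectedOn : Subset n → Set
  ConnectedOn S = ∀ u v → u ∈ S → v ∈ S → ReachIn S u v

  -- G is connected (a graph has at least one vertex)
  Connected : Set
  Connected = Fin n × (∀ (u v : Fin n) → ReachIn (Data.Fin.Subset.⊤) u v)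

  NonSeparable : Subset n → Set
  NonSeparable S = (∃ λ v → v ∈ S) × ConnectedOn S × (∀ v → v ∈ S → ConnectedOn (S - v))

  -- a block: a maximal connected subgraph without a cut vertex
  -- (blocks are induced subgraphs, so identified by their vertex sets)
  IsBlock : Subset n → Set
  IsBlock S = NonSeparable S × (∀ T → S ⊆ T → NonSeparable T → T ⊆ S)

  -- G[S] is isomorphic to a cycle of even length (≥ 4, as G is simple)
  IsEvenCycleOn : Subset n → Set
  IsEvenCycleOn S =
    Σ ℕ λ k →
    let L = suc (suc (suc (suc (k * 2)))) in
    Σ (Fin L → Fin n) λ f →
      Injective _≡_ _≡_ f ×
      (∀ v → v ∈ S → ∃ λ i → f i ≡ v) ×
      (∀ i → f i ∈ S) ×
      (∀ i j → (Adj (f i) (f j) → (j ≡ suc (toℕ i) mod L ⊎ i ≡ suc (toℕ j) mod L))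
             × ((j ≡ suc (toℕ i) mod L ⊎ i ≡ suc (toℕ j) mod L) → Adj (f i) (f j)))

  IsEdgeOn : Subset n → Set
  IsEdgeOn S = Σ (Fin n) λ u → Σ (Fin n) λ v → u ≢ v × Adj u v ×
               (∀ w → w ∈ S → (w ≡ u ⊎ w ≡ v)) × u ∈ S × v ∈ S

  IsSBEP : Set
  IsSBEP = Connected ×
           (∀ S → IsBlock S → IsEvenCycleOn S ⊎ IsEdgeOn S) ×
           (∀ v S₁ S₂ S₃ → IsBlock S₁ → IsBlock S₂ → IsBlock S₃ →
              v ∈ S₁ → v ∈ S₂ → v ∈ S₃ → S₁ ≡ S₂ ⊎ S₁ ≡ S₃ ⊎ S₂ ≡ S₃)

  PrismAdj : Fin n × Bool → Fin n × Bool → Set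
  PrismAdj (u , a) (v , b) = (a ≡ b × Adj u v) ⊎ (u ≡ v × a ≢ b)

HamiltonianCycle : (V : Set) → (V → V → Set) → Set
HamiltonianCycle V R =
  Σ ℕ λ m → let L = suc (suc (suc m)) in
  Σ (Fin L → V) λ f →
    Injective _≡_ _≡_ f × Surjective _≡_ _≡_ f ×
    (∀ i → R (f i) (f (suc (toℕ i) mod L)))

PrismHamiltonian : Graph → Set
PrismHamiltonian G = HamiltonianCycle (Fin (Graph.n G) × Bool) (PrismAdj G)

module Submission where

-- The prism cycle is built block by block. Every block B of an SBEP graph is an even
-- cycle or an edge, so for u ∈ B it can be traversed as a closed walk u, v₁, …, vₘ, u
-- with m odd. Zigzagging along it, (v₁,a) (v₁,¬a) (v₂,¬a) (v₂,a) …, gives a path of the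
-- prism from (u,a) to (u,¬a) through all of (B - u) × Bool, which replaces the rung
-- (u,a)(u,¬a) of the current cycle. Starting from one block, blocks sharing a vertex u
-- with the covered set S are attached one at a time. For this to continue, the cycle
-- must use the rung at every vertex of S that still has a neighbour outside S: the new
-- cycle uses the rung at every vertex of B - u, and u has no neighbour left outside
-- because it lies in at most two blocks. That B meets S only in u follows from the
-- invariant that every vertex outside S enters S at a single vertex; attaching B
-- preserves it, since a second entry point would give B an ear, contradicting its
-- maximality.

open import Defs
open import Data.Nat as ℕ using (ℕ; zero; suc; _≤_; _+_; _*_; z≤n; s≤s)
import Data.Nat.Properties as ℕ
open import Data.Nat.DivMod using (_mod_; _%_; m<n⇒m%n≡m; n%n≡0)
open import Data.Fin as Fin using (Fin; toℕ; _≟_)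
import Data.Fin.Properties as Fin
open import Data.Fin.Subset as Subset using (Subset; _∈_; _∉_; _⊆_; _⊂_; _⊃_; _-_; _─_; _∪_; ⁅_⁆; ⋃)
open import Data.Fin.Subset.Properties
open import Data.Fin.Subset.Induction using (⊂-wellFounded; ⊃-wellFounded)
import Data.Vec as Vec
open import Data.Bool as Bool using (Bool; true; false; not)
import Data.Bool.Properties as Bool
open import Data.Product
open import Data.Sum as Sum using (_⊎_; inj₁; inj₂; [_,_]′)
open import Data.Empty
open import Data.Unit using (⊤; tt)
open import Data.List as List using (List; []; _∷_; _++_; _∷ʳ_; length; take; lookup)
import Data.List.Properties as List
open import Data.List.Relation.Unary.Linked as Linked using (Linked; []; [-]; _∷_)
open import Data.List.Relation.Unary.All as All using (All; []; _∷_)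
open import Data.List.Relation.Unary.All.Properties using (¬Any⇒All¬; All¬⇒¬Any; ¬All⇒Any¬)
open import Data.List.Relation.Unary.Any as Any using (here; there)
import Data.List.Relation.Unary.Any.Properties as Any
open import Data.List.Relation.Unary.AllPairs using ([]; _∷_)
open import Data.List.Relation.Unary.Unique.Propositional using (Unique)
import Data.List.Relation.Unary.Unique.Propositional.Properties as Unique
open import Data.List.Membership.Propositional using (find) renaming (_∈_ to _∈ₗ_)
open import Data.List.Membership.Propositional.Properties
open import Data.List.Relation.Binary.Permutation.Propositional using (_↭_; ↭-sym; ↭-trans; prep; ↭⇒↭ₛ)
open import Data.List.Relation.Binary.Permutation.Propositional.Properties using (shift; shifts; ++-comm; ∈-resp-↭; ↭-length)
import Data.List.Relation.Binary.Permutation.Setoid.Properties as Permutationₛ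
open import Induction.WellFounded using (Acc; acc)
open import Relation.Binary.Definitions using (_Respects_)
open import Relation.Binary.PropositionalEquality
open import Relation.Nullary
open import Relation.Nullary.Decidable using (_×-dec_; _→-dec_; ¬?; decidable-stable)
open import Function using (_∘_; id)

module _ {A : Set} where

  Unique-resp-↭ : Unique {A = A} Respects _↭_
  Unique-resp-↭ p = Permutationₛ.Unique-resp-↭ (setoid A) (↭⇒↭ₛ p)

  Unique-lookup-injective : ∀ {xs : List A} → Unique xs → ∀ i j → lookup xs i ≡ lookup xs j → i ≡ j
  Unique-lookup-injective (_ ∷ _) Fin.zero Fin.zero _ = refl
  Unique-lookup-injective (x∉xs ∷ _) Fin.zero (Fin.suc j) e = ⊥-elim (All¬⇒¬Any x∉xs (subst (_∈ₗ _) (sym e) (∈-lookup j)))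
  Unique-lookup-injective (x∉xs ∷ _) (Fin.suc i) Fin.zero e = ⊥-elim (All¬⇒¬Any x∉xs (subst (_∈ₗ _) e (∈-lookup i)))
  Unique-lookup-injective (_ ∷ u) (Fin.suc i) (Fin.suc j) e = cong Fin.suc (Unique-lookup-injective u i j e)

  data Consecutive (p q : A) : List A → Set where
    here  : ∀ {xs} → Consecutive p q (p ∷ q ∷ xs)
    there : ∀ {x xs} → Consecutive p q xs → Consecutive p q (x ∷ xs)

  module _ {p q : A} where

    Consecutive-++⁺ˡ : ∀ {xs} ys → Consecutive p q xs → Consecutive p q (xs ++ ys)
    Consecutive-++⁺ˡ ys here = here
    Consecutive-++⁺ˡ ys (there c) = there (Consecutive-++⁺ˡ ys c)

    Consecutive-++⁺ʳ : ∀ xs {ys} → Consecutive p q ys → Consecutive p q (xs ++ ys)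
    Consecutive-++⁺ʳ [] c = c
    Consecutive-++⁺ʳ (x ∷ xs) c = there (Consecutive-++⁺ʳ xs c)

    Consecutive⇒∃++ : ∀ {xs} → Consecutive p q xs → ∃₂ λ ys zs → xs ≡ ys ++ p ∷ q ∷ zs
    Consecutive⇒∃++ (here {xs}) = [] , xs , refl
    Consecutive⇒∃++ (there {x} c) with Consecutive⇒∃++ c
    ... | ys , zs , refl = x ∷ ys , zs , refl

    Consecutive-insert : ∀ xs {r s ys} mid → Consecutive p q (xs ++ r ∷ s ∷ ys) →
                         p ≢ r → q ≢ r → p ≢ s → Consecutive p q (xs ++ r ∷ mid ++ s ∷ ys)
    Consecutive-insert [] mid here p≢r _ _ = ⊥-elim (p≢r refl)
    Consecutive-insert [] mid (there here) _ _ p≢s = ⊥-elim (p≢s refl)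
    Consecutive-insert [] mid (there (there c)) _ _ _ = there (Consecutive-++⁺ʳ mid (there c))
    Consecutive-insert (x ∷ []) mid here _ q≢r _ = ⊥-elim (q≢r refl)
    Consecutive-insert (x ∷ []) mid (there c) p≢r q≢r p≢s = there (Consecutive-insert [] mid c p≢r q≢r p≢s)
    Consecutive-insert (x ∷ y ∷ xs) mid here _ _ _ = here
    Consecutive-insert (x ∷ y ∷ xs) mid (there c) p≢r q≢r p≢s = there (Consecutive-insert (y ∷ xs) mid c p≢r q≢r p≢s)

  take-1-++-∷ : ∀ xs p (ys zs : List A) → take 1 (xs ++ p ∷ ys) ≡ take 1 (xs ++ p ∷ zs)
  take-1-++-∷ [] _ _ _ = refl
  take-1-++-∷ (_ ∷ _) _ _ _ = refl

  length-insert : ∀ xs (p : A) mid q ys → 2 + length mid ≤ length (xs ++ p ∷ mid ++ q ∷ ys)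
  length-insert [] p [] q ys = s≤s (s≤s z≤n)
  length-insert [] p (m ∷ mid) q ys = s≤s (length-insert [] m mid q ys)
  length-insert (x ∷ xs) p mid q ys = ℕ.m≤n⇒m≤1+n (length-insert xs p mid q ys)

  CyclicallyLinked : (A → A → Set) → List A → Set
  CyclicallyLinked R xs = Linked R (xs ++ take 1 xs)

  module _ {R : A → A → Set} where

    Linked-split : ∀ xs {m ys} → Linked R (xs ++ m ∷ ys) → Linked R (xs ∷ʳ m) × Linked R (m ∷ ys)
    Linked-split [] l = [-] , l
    Linked-split (x ∷ []) (r ∷ l) = r ∷ [-] , l
    Linked-split (x ∷ y ∷ xs) (r ∷ l) = map₁ (r ∷_) (Linked-split (y ∷ xs) l)

    Linked-join : ∀ xs {m ys} → Linked R (xs ∷ʳ m) → Linked R (m ∷ ys) → Linked R (xs ++ m ∷ ys)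
    Linked-join [] _ l = l
    Linked-join (x ∷ []) (r ∷ [-]) l = r ∷ l
    Linked-join (x ∷ y ∷ xs) (r ∷ l′) l = r ∷ Linked-join (y ∷ xs) l′ l

    Linked-lookup : ∀ xs {z} → Linked R (xs ∷ʳ z) → ∀ (i j : Fin (length xs)) →
                    toℕ j ≡ suc (toℕ i) → R (lookup xs i) (lookup xs j)
    Linked-lookup (x ∷ []) l Fin.zero Fin.zero ()
    Linked-lookup (x ∷ y ∷ xs) (r ∷ l) Fin.zero (Fin.suc Fin.zero) e = r
    Linked-lookup (x ∷ y ∷ xs) (r ∷ l) (Fin.suc i) (Fin.suc j) e = Linked-lookup (y ∷ xs) l i j (ℕ.suc-injective e)

    Linked-lookup-last : ∀ xs {z} → Linked R (xs ∷ʳ z) → ∀ (i : Fin (length xs)) →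
                         suc (toℕ i) ≡ length xs → R (lookup xs i) z
    Linked-lookup-last (x ∷ []) (r ∷ [-]) Fin.zero e = r
    Linked-lookup-last (x ∷ y ∷ xs) (r ∷ l) (Fin.suc i) e = Linked-lookup-last (y ∷ xs) l i (ℕ.suc-injective e)

    Linked-tabulate : ∀ {m} (g : Fin (suc m) → A) z → (∀ (i : Fin m) → R (g (Fin.inject₁ i)) (g (Fin.suc i))) →
                      R (g (Fin.fromℕ m)) z → Linked R (List.tabulate g ∷ʳ z)
    Linked-tabulate {zero} g z _ e = e ∷ [-]
    Linked-tabulate {suc m} g z steps e = steps Fin.zero ∷ Linked-tabulate (g ∘ Fin.suc) z (steps ∘ Fin.suc) e

    CyclicallyLinked-rotate : ∀ xs u ys → CyclicallyLinked R (xs ++ u ∷ ys) → Linked R (u ∷ (ys ++ xs) ∷ʳ u)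
    CyclicallyLinked-rotate [] u ys l = subst (λ t → Linked R (u ∷ t ∷ʳ u)) (sym (List.++-identityʳ ys)) l
    CyclicallyLinked-rotate (x ∷ xs) u ys l
      with l₁ , l₂ ← Linked-split (x ∷ xs) (subst (Linked R) (List.++-assoc (x ∷ xs) (u ∷ ys) (x ∷ [])) l)
      = subst (λ t → Linked R (u ∷ t)) (sym (List.++-assoc ys (x ∷ xs) (u ∷ []))) (Linked-join (u ∷ ys) l₂ l₁)

    CyclicallyLinked-insert : ∀ xs p q ys mid → CyclicallyLinked R (xs ++ p ∷ q ∷ ys) →
                              Linked R (p ∷ mid ∷ʳ q) → CyclicallyLinked R (xs ++ p ∷ mid ++ q ∷ ys)
    CyclicallyLinked-insert xs p q ys mid l l′
      rewrite take-1-++-∷ xs p (mid ++ q ∷ ys) (q ∷ ys)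
            | List.++-assoc xs (p ∷ q ∷ ys) (take 1 (xs ++ p ∷ q ∷ ys))
            | List.++-assoc xs (p ∷ mid ++ q ∷ ys) (take 1 (xs ++ p ∷ q ∷ ys))
            | List.++-assoc mid (q ∷ ys) (take 1 (xs ++ p ∷ q ∷ ys))
      with l₁ , l₂ ← Linked-split xs l
      = Linked-join xs l₁ (Linked-join (p ∷ mid) l′ (Linked.tail l₂))

    CyclicallyLinked⇒HamiltonianCycle : (C : List A) → Unique C → (∀ v → v ∈ₗ C) →
                                        CyclicallyLinked R C → 3 ≤ length C → HamiltonianCycle A R
    CyclicallyLinked⇒HamiltonianCycle (_ ∷ []) _ _ _ (s≤s ())
    CyclicallyLinked⇒HamiltonianCycle (_ ∷ _ ∷ []) _ _ _ (s≤s (s≤s ()))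
    CyclicallyLinked⇒HamiltonianCycle C@(_ ∷ _ ∷ _ ∷ rest) unique covers closed _ =
      length rest , lookup C , Unique-lookup-injective unique _ _ , surjective , linked
      where
      L : ℕ
      L = length C
      surjective : ∀ y → ∃ λ i → ∀ {z} → z ≡ i → lookup C z ≡ y
      surjective y = Any.index (covers y) , λ { refl → sym (Any.lookup-index (covers y)) }
      linked : ∀ i → R (lookup C i) (lookup C (suc (toℕ i) mod L))
      linked i with suc (toℕ i) ℕ.<? L
      ... | yes i+1<L = Linked-lookup C closed i _ (trans (Fin.toℕ-fromℕ< _) (m<n⇒m%n≡m i+1<L))
      ... | no i+1≮L = subst (R (lookup C i) ∘ lookup C) (sym wraps) (Linked-lookup-last C closed i i+1≡L)
        where
        i+1≡L : suc (toℕ i) ≡ L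
        i+1≡L = ℕ.≤-antisym (Fin.toℕ<n i) (ℕ.≮⇒≥ i+1≮L)
        wraps : suc (toℕ i) mod L ≡ Fin.zero
        wraps = Fin.toℕ-injective (trans (Fin.toℕ-fromℕ< _) (trans (cong (_% L) i+1≡L) (n%n≡0 L)))

x∈p─q⇒x∉q : ∀ {n} (p q : Subset n) {x} → x ∈ p ─ q → x ∉ q
x∈p─q⇒x∉q (_ Vec.∷ p) (false Vec.∷ q) {Fin.zero} _ ()
x∈p─q⇒x∉q (_ Vec.∷ p) (true Vec.∷ q) {Fin.zero} () _
x∈p─q⇒x∉q (_ Vec.∷ p) (_ Vec.∷ q) {Fin.suc x} (Vec.there x∈p─q) (Vec.there x∈q) = x∈p─q⇒x∉q p q x∈p─q x∈q

module _ {n : ℕ} where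

  x∈p-y⇒x∈p∧x≢y : ∀ {p : Subset n} {x y} → x ∈ p - y → x ∈ p × x ≢ y
  x∈p-y⇒x∈p∧x≢y {p} {x} {y} x∈p-y =
    p─q⊆p p ⁅ y ⁆ x∈p-y , λ { refl → x∈p─q⇒x∉q p ⁅ x ⁆ x∈p-y (x∈⁅x⁆ x) }

  x∉p∧y∈p⇒x≢y : ∀ {p : Subset n} {x y} → x ∉ p → y ∈ p → x ≢ y
  x∉p∧y∈p⇒x≢y x∉p y∈p refl = x∉p y∈p

  x∈p∪q∧x∉p⇒x∈q : ∀ {p q : Subset n} {x} → x ∈ p ∪ q → x ∉ p → x ∈ q
  x∈p∪q∧x∉p⇒x∈q {p} {q} x∈p∪q x∉p = [ ⊥-elim ∘ x∉p , id ]′ (x∈p∪q⁻ p q x∈p∪q)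

  fromList : List (Fin n) → Subset n
  fromList xs = ⋃ (List.map ⁅_⁆ xs)

  ∈-fromList⁺ : ∀ {x xs} → x ∈ₗ xs → x ∈ fromList xs
  ∈-fromList⁺ {xs = y ∷ _} (here refl) = x∈p∪q⁺ (inj₁ (x∈⁅x⁆ y))
  ∈-fromList⁺ (there x∈xs) = x∈p∪q⁺ (inj₂ (∈-fromList⁺ x∈xs))

  ∈-fromList⁻ : ∀ {x xs} → x ∈ fromList xs → x ∈ₗ xs
  ∈-fromList⁻ {xs = []} x∈⊥ = ⊥-elim (∉⊥ x∈⊥)
  ∈-fromList⁻ {xs = y ∷ xs} x∈ with x∈p∪q⁻ ⁅ y ⁆ (fromList xs) x∈
  ... | inj₁ x∈⁅y⁆ = here (x∈⁅y⁆⇒x≡y y x∈⁅y⁆)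
  ... | inj₂ x∈xs = there (∈-fromList⁻ x∈xs)

  module _ {P Q : Subset n → Set} (step : ∀ {S} → P S → (∃ λ S′ → S ⊂ S′ × P S′) ⊎ Q S) where

    saturate : ∀ {S} → P S → ∃ λ S → P S × Q S
    saturate {S} = go (⊃-wellFounded S)
      where
      go : ∀ {S} → Acc _⊃_ S → P S → ∃ λ S → P S × Q S
      go (acc rec) p with step p
      ... | inj₁ (_ , S⊂S′ , p′) = go (rec S⊂S′) p′
      ... | inj₂ q = _ , p , q

notⁿ : ℕ → Bool → Bool
notⁿ zero a = a
notⁿ (suc k) a = notⁿ k (not a)

notⁿ-odd : ∀ k a → notⁿ (suc (k * 2)) a ≡ not a
notⁿ-odd zero a = refl
notⁿ-odd (suc k) a = trans (notⁿ-odd k (not (not a))) (cong not (Bool.not-involutive a))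

module _ (G : Graph) where
  open Graph G using (n; adj)

  private
    V : Set
    V = Fin n

  infix 4 _~_
  _~_ : V → V → Set
  _~_ = Adj G

  ~-sym : ∀ {u v} → u ~ v → v ~ u
  ~-sym {u} {v} = trans (Graph.sym G v u)

  _~?_ : ∀ u v → Dec (u ~ v)
  u ~? v = adj u v Bool.≟ true

  -- Walks and blocks

  infixr 5 _∷⟨_⟩_
  data Walk (P : V → Set) : V → V → Set where
    stop   : ∀ {v} → P v → Walk P v v
    _∷⟨_⟩_ : ∀ {u w v} → P u → u ~ w → Walk P w v → Walk P u v

  module _ {P : V → Set} where

    Walk-start : ∀ {u v} → Walk P u v → P u
    Walk-start (stop p) = p
    Walk-start (p ∷⟨ _ ⟩ _) = p

    Walk-end : ∀ {u v} → Walk P u v → P v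
    Walk-end (stop p) = p
    Walk-end (_ ∷⟨ _ ⟩ r) = Walk-end r

    infixr 5 _++ʷ_
    _++ʷ_ : ∀ {u x v} → Walk P u x → Walk P x v → Walk P u v
    stop _ ++ʷ r = r
    (p ∷⟨ e ⟩ q) ++ʷ r = p ∷⟨ e ⟩ (q ++ʷ r)

    Walk-reverse : ∀ {u v} → Walk P u v → Walk P v u
    Walk-reverse (stop p) = stop p
    Walk-reverse (p ∷⟨ e ⟩ q) = Walk-reverse q ++ʷ (Walk-start q ∷⟨ ~-sym e ⟩ stop p)

    vertices : ∀ {u v} → Walk P u v → List V
    vertices (stop {v} _) = v ∷ []
    vertices (_∷⟨_⟩_ {u} _ _ q) = u ∷ vertices q

    All-vertices : ∀ {u v} (w : Walk P u v) → All P (vertices w)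
    All-vertices (stop p) = p ∷ []
    All-vertices (p ∷⟨ _ ⟩ q) = p ∷ All-vertices q

    Walk-restrict : ∀ {Q u v} (w : Walk P u v) → All Q (vertices w) → Walk Q u v
    Walk-restrict (stop _) (q ∷ []) = stop q
    Walk-restrict (_ ∷⟨ e ⟩ r) (q ∷ qs) = q ∷⟨ e ⟩ Walk-restrict r qs

    start∈vertices : ∀ {u v} (w : Walk P u v) → u ∈ₗ vertices w
    start∈vertices (stop _) = here refl
    start∈vertices (_ ∷⟨ _ ⟩ _) = here refl

    Simple : ∀ {u v} → Walk P u v → Set
    Simple w = Unique (vertices w)

    suffix : ∀ {x v u} (w : Walk P x v) → Simple w → u ∈ₗ vertices w →
             Σ (Walk P u v) λ w′ → Simple w′ × (∀ {z} → z ∈ₗ vertices w′ → z ∈ₗ vertices w)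
    suffix (stop p) s (here refl) = stop p , s , id
    suffix (p ∷⟨ e ⟩ r) s (here refl) = p ∷⟨ e ⟩ r , s , id
    suffix (_ ∷⟨ _ ⟩ r) (_ ∷ s) (there m) with w′ , s′ , sub ← suffix r s m = w′ , s′ , there ∘ sub

    simplify : ∀ {u v} (w : Walk P u v) →
               Σ (Walk P u v) λ w′ → Simple w′ × (∀ {z} → z ∈ₗ vertices w′ → z ∈ₗ vertices w)
    simplify (stop p) = stop p , [] ∷ [] , id
    simplify (_∷⟨_⟩_ {u} p e r) with r′ , s′ , sub ← simplify r with Any.any? (u ≟_) (vertices r′)
    ... | yes u∈r′ with w″ , s″ , sub′ ← suffix r′ s′ u∈r′ = w″ , s″ , there ∘ sub ∘ sub′
    ... | no u∉r′ = p ∷⟨ e ⟩ r′ , ¬Any⇒All¬ _ u∉r′ ∷ s′ , λ { (here e) → here e ; (there m) → there (sub m) }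

    split-at : ∀ {p q s} (w : Walk P p q) → Simple w → s ∈ₗ vertices w →
               Σ (Walk P p s) λ w₁ → Σ (Walk P s q) λ w₂ →
                 (∀ {z} → z ∈ₗ vertices w₁ → z ∈ₗ vertices w) ×
                 (∀ {z} → z ∈ₗ vertices w₂ → z ∈ₗ vertices w) ×
                 (∀ {z} → z ∈ₗ vertices w₁ → z ∈ₗ vertices w₂ → z ≡ s)
    split-at (stop p) _ (here refl) = stop p , stop p , id , id , λ { (here e) _ → e }
    split-at (p ∷⟨ e ⟩ r) _ (here refl) = stop p , p ∷⟨ e ⟩ r , (λ { (here e) → here e }) , id , λ { (here e) _ → e }
    split-at (p ∷⟨ e ⟩ r) (u∉r ∷ sr) (there m) with w₁ , w₂ , sub₁ , sub₂ , meet ← split-at r sr m =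
      p ∷⟨ e ⟩ w₁ , w₂ , (λ { (here e) → here e ; (there z) → there (sub₁ z) }) , there ∘ sub₂ ,
      λ { (here refl) z₂ → ⊥-elim (All¬⇒¬Any u∉r (sub₂ z₂)) ; (there z₁) z₂ → meet z₁ z₂ }

  Walk-map : ∀ {P Q : V → Set} → (∀ {x} → P x → Q x) → ∀ {u v} → Walk P u v → Walk Q u v
  Walk-map f (stop p) = stop (f p)
  Walk-map f (p ∷⟨ e ⟩ q) = f p ∷⟨ e ⟩ Walk-map f q

  ReachIn⇒Walk : ∀ {S u v} → ReachIn G S u v → Walk (_∈ S) u v
  ReachIn⇒Walk (here x) = stop x
  ReachIn⇒Walk (step x e r) = x ∷⟨ e ⟩ ReachIn⇒Walk r

  Walk⇒ReachIn : ∀ {S u v} → Walk (_∈ S) u v → ReachIn G S u v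
  Walk⇒ReachIn (stop x) = here x
  Walk⇒ReachIn (x ∷⟨ e ⟩ r) = step x e (Walk⇒ReachIn r)

  first-neighbour : ∀ {Q : V → Set} {a y} → Walk (λ x → Q x ⊎ x ≡ a) y a → y ≢ a →
                    ∃ λ c → Walk Q y c × c ~ a
  first-neighbour (stop _) y≢a = ⊥-elim (y≢a refl)
  first-neighbour (inj₂ y≡a ∷⟨ _ ⟩ _) y≢a = ⊥-elim (y≢a y≡a)
  first-neighbour {a = a} (_∷⟨_⟩_ {w = w} (inj₁ q) e r) _ with w ≟ a
  ... | yes refl = _ , stop q , e
  ... | no w≢a with c , r′ , c~a ← first-neighbour r w≢a = c , q ∷⟨ e ⟩ r′ , c~a

  EntryWalk : Subset n → V → V → Set
  EntryWalk S y a = Walk (λ x → x ∉ S ⊎ x ≡ a) y a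

  first-entry : ∀ {Q : V → Set} {S y x} → Walk Q y x → y ∉ S → x ∈ S →
                ∃ λ x′ → x′ ∈ S × Q x′ × EntryWalk S y x′
  first-entry (stop _) y∉S x∈S = ⊥-elim (y∉S x∈S)
  first-entry {S = S} (_∷⟨_⟩_ {w = z} _ e r) y∉S x∈S with z ∈? S
  ... | yes z∈S = z , z∈S , Walk-start r , inj₁ y∉S ∷⟨ e ⟩ stop (inj₂ refl)
  ... | no z∉S with x′ , x′∈S , qx′ , r′ ← first-entry r z∉S x∈S =
    x′ , x′∈S , qx′ , inj₁ y∉S ∷⟨ e ⟩ r′

  ReachIn-start : ∀ {S u v} → ReachIn G S u v → u ∈ S
  ReachIn-start (here x) = x
  ReachIn-start (step x _ _) = x

  ReachIn-mono : ∀ {S T} → S ⊆ T → ∀ {u v} → ReachIn G S u v → ReachIn G T u v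
  ReachIn-mono S⊆T (here x) = here (S⊆T x)
  ReachIn-mono S⊆T (step x e r) = step (S⊆T x) e (ReachIn-mono S⊆T r)

  ReachIn-avoid : ∀ {S x v} u → ReachIn G S x v → v ≢ u →
                  ReachIn G (S - u) x v ⊎ ∃ λ w → u ~ w × ReachIn G (S - u) w v
  ReachIn-avoid u (here v∈S) v≢u = inj₁ (here (x∈p∧x≢y⇒x∈p-y v∈S v≢u))
  ReachIn-avoid u (step {x} x∈S e r) v≢u with ReachIn-avoid u r v≢u
  ... | inj₂ exit = inj₂ exit
  ... | inj₁ r′ with x ≟ u
  ...   | yes refl = inj₂ (_ , e , r′)
  ...   | no x≢u = inj₁ (step (x∈p∧x≢y⇒x∈p-y x∈S x≢u) e r′)

  ReachIn-dec : ∀ S u v → Dec (ReachIn G S u v)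
  ReachIn-dec S = go (⊂-wellFounded S)
    where
    go : ∀ {S} → Acc _⊂_ S → ∀ u v → Dec (ReachIn G S u v)
    go {S} (acc rec) u v with u ∈? S
    ... | no u∉S = no (u∉S ∘ ReachIn-start)
    ... | yes u∈S with u ≟ v
    ...   | yes refl = yes (here u∈S)
    ...   | no u≢v with Fin.any? (λ w → (u ~? w) ×-dec go (rec (x∈p⇒p-x⊂p u∈S)) w v)
    ...     | yes (w , e , r) = yes (step u∈S e (ReachIn-mono (p─q⊆p S _) r))
    ...     | no ∄w = no λ r → [ (λ r′ → proj₂ (x∈p-y⇒x∈p∧x≢y (ReachIn-start r′)) refl) , ∄w ]′
                                 (ReachIn-avoid u r (u≢v ∘ sym))

  ConnectedOn-dec : ∀ S → Dec (ConnectedOn G S)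
  ConnectedOn-dec S = Fin.all? λ u → Fin.all? λ v → (u ∈? S) →-dec ((v ∈? S) →-dec ReachIn-dec S u v)

  NonSeparable-dec : ∀ S → Dec (NonSeparable G S)
  NonSeparable-dec S = Fin.any? (_∈? S) ×-dec ConnectedOn-dec S ×-dec
                       Fin.all? (λ v → (v ∈? S) →-dec ConnectedOn-dec (S - v))

  NonSeparable⇒⊆IsBlock : ∀ {T} → NonSeparable G T → ∃ λ B → T ⊆ B × IsBlock G B
  NonSeparable⇒⊆IsBlock {T} ns =
    let B , (T⊆B , nsB) , maximal = saturate enlarge (id , ns) in B , T⊆B , nsB , maximal
    where
    Maximal : Subset n → Set
    Maximal S = ∀ S′ → S ⊆ S′ → NonSeparable G S′ → S′ ⊆ S
    enlarge : ∀ {S} → T ⊆ S × NonSeparable G S →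
              (∃ λ S′ → S ⊂ S′ × T ⊆ S′ × NonSeparable G S′) ⊎ Maximal S
    enlarge {S} (T⊆S , _) with anySubset? (λ S′ → (S ⊂? S′) ×-dec NonSeparable-dec S′)
    ... | yes (S′ , S⊂S′ , ns′) = inj₁ (S′ , S⊂S′ , proj₁ S⊂S′ ∘ T⊆S , ns′)
    ... | no ∄S′ = inj₂ λ S′ S⊆S′ ns′ {x} x∈S′ →
                     decidable-stable (x ∈? S) λ x∉S → ∄S′ (S′ , (S⊆S′ , x , x∈S′ , x∉S) , ns′)

  IsBlock⇒ConnectedOn : ∀ {B} → IsBlock G B → ConnectedOn G B
  IsBlock⇒ConnectedOn = proj₁ ∘ proj₂ ∘ proj₁

  IsBlock⇒ConnectedOn- : ∀ {B} → IsBlock G B → ∀ z → z ∈ B → ConnectedOn G (B - z)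
  IsBlock⇒ConnectedOn- = proj₂ ∘ proj₂ ∘ proj₁

  ⁅⁆-nonSeparable : ∀ v → NonSeparable G ⁅ v ⁆
  ⁅⁆-nonSeparable v = (v , x∈⁅x⁆ v) , (λ s t s∈ t∈ → stay s∈ t∈ s∈) ,
                      λ z _ s t s∈ t∈ → stay (p─q⊆p _ _ s∈) (p─q⊆p _ _ t∈) s∈
    where
    stay : ∀ {S s t} → s ∈ ⁅ v ⁆ → t ∈ ⁅ v ⁆ → s ∈ S → ReachIn G S s t
    stay s∈ t∈ s∈S with refl ← x∈⁅y⁆⇒x≡y v s∈ | refl ← x∈⁅y⁆⇒x≡y v t∈ = here s∈S

  edge-nonSeparable : ∀ {u w} → u ~ w → NonSeparable G (⁅ u ⁆ ∪ ⁅ w ⁆)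
  edge-nonSeparable {u} {w} u~w =
    (u , x∈p∪q⁺ (inj₁ (x∈⁅x⁆ u))) ,
    (λ s t s∈ t∈ → reach (ends s∈) (ends t∈) s∈ t∈) ,
    λ z _ s t s∈ t∈ → reach (ends (p─q⊆p _ _ s∈)) (ends (p─q⊆p _ _ t∈)) s∈ t∈
    where
    ends : ∀ {x} → x ∈ ⁅ u ⁆ ∪ ⁅ w ⁆ → x ≡ u ⊎ x ≡ w
    ends x∈ = [ inj₁ ∘ x∈⁅y⁆⇒x≡y u , inj₂ ∘ x∈⁅y⁆⇒x≡y w ]′ (x∈p∪q⁻ _ _ x∈)
    reach : ∀ {S s t} → s ≡ u ⊎ s ≡ w → t ≡ u ⊎ t ≡ w → s ∈ S → t ∈ S → ReachIn G S s t
    reach (inj₁ refl) (inj₁ refl) s∈ _ = here s∈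
    reach (inj₁ refl) (inj₂ refl) s∈ t∈ = step s∈ u~w (here t∈)
    reach (inj₂ refl) (inj₁ refl) s∈ t∈ = step s∈ (~-sym u~w) (here t∈)
    reach (inj₂ refl) (inj₂ refl) s∈ _ = here s∈

  vertex-block : ∀ v → ∃ λ B → IsBlock G B × v ∈ B
  vertex-block v with B , v⊆B , B-block ← NonSeparable⇒⊆IsBlock (⁅⁆-nonSeparable v) =
    B , B-block , v⊆B (x∈⁅x⁆ v)

  edge-block : ∀ {u w} → u ~ w → ∃ λ B → IsBlock G B × u ∈ B × w ∈ B
  edge-block u~w with B , uw⊆B , B-block ← NonSeparable⇒⊆IsBlock (edge-nonSeparable u~w) =
    B , B-block , uw⊆B (x∈p∪q⁺ (inj₁ (x∈⁅x⁆ _))) , uw⊆B (x∈p∪q⁺ (inj₂ (x∈⁅x⁆ _)))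

  module Ear {B} (B-block : IsBlock G B) {a b p q} (a∈B : a ∈ B) (b∈B : b ∈ B) (a≢b : a ≢ b)
             (a~p : a ~ p) (w : Walk (_∉ B) p q) (w-simple : Simple w) (q~b : q ~ b) where

    private
      T : Subset n
      T = B ∪ fromList (vertices w)

      B⊆T : B ⊆ T
      B⊆T = p⊆p∪q _

      w⊆T : ∀ {x} → x ∈ₗ vertices w → x ∈ T
      w⊆T = x∈p∪q⁺ ∘ inj₂ ∘ ∈-fromList⁺

      -- Walks inside T through vertices satisfying Ok, where at most one vertex fails Ok:
      -- Ok = ⊤ gives connectivity of T, Ok = (_≢ z) that of T - z.
      module Avoiding (Ok : V → Set) (Ok? : ∀ x → Dec (Ok x)) (≤1-bad : ∀ {x y} → ¬ Ok x → ¬ Ok y → x ≡ y) where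

        OkT : V → Set
        OkT x = x ∈ T × Ok x

        Failure : V → List V → Set
        Failure x l = ¬ Ok x ⊎ ∃ λ z → z ∈ₗ l × ¬ Ok z

        failure : ∀ {x} l → ¬ (All Ok l × Ok x) → Failure x l
        failure {x} l ¬ok with Ok? x
        ... | no ¬ok-x = inj₁ ¬ok-x
        ... | yes ok-x = inj₂ (find (¬All⇒Any¬ Ok? l (λ ok-l → ¬ok (ok-l , ok-x))))

        -- Along the ear, one of the two directions from s avoids the unique bad vertex.
        reach-block : ∀ {s} → s ∈ T → Ok s → ∃ λ h → h ∈ B × Ok h × Walk OkT s h
        reach-block {s} s∈T ok-s with x∈p∪q⁻ B _ s∈T
        ... | inj₁ s∈B = s , s∈B , ok-s , stop (s∈T , ok-s)
        ... | inj₂ s∈w with w₁ , w₂ , sub₁ , sub₂ , meet ← split-at w w-simple (∈-fromList⁻ s∈w)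
                       with All.all? Ok? (vertices w₁) ×-dec Ok? a
        ...   | yes (ok₁ , ok-a) =
          a , a∈B , ok-a , Walk-reverse w₁′ ++ʷ Walk-start w₁′ ∷⟨ ~-sym a~p ⟩ stop (B⊆T a∈B , ok-a)
          where
          w₁′ : Walk OkT p s
          w₁′ = Walk-restrict w₁ (All.tabulate λ m → w⊆T (sub₁ m) , All.lookup ok₁ m)
        ...   | no bad₁ with All.all? Ok? (vertices w₂) ×-dec Ok? b
        ...     | yes (ok₂ , ok-b) =
          b , b∈B , ok-b , w₂′ ++ʷ Walk-end w₂′ ∷⟨ q~b ⟩ stop (B⊆T b∈B , ok-b)
          where
          w₂′ : Walk OkT s q
          w₂′ = Walk-restrict w₂ (All.tabulate λ m → w⊆T (sub₂ m) , All.lookup ok₂ m)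
        ...     | no bad₂ = ⊥-elim (both-bad (failure (vertices w₁) bad₁) (failure (vertices w₂) bad₂))
          where
          outside : ∀ {x} → x ∈ₗ vertices w → x ∉ B
          outside = All.lookup (All-vertices w)
          both-bad : Failure a (vertices w₁) → Failure b (vertices w₂) → ⊥
          both-bad (inj₁ ¬ok-a) (inj₁ ¬ok-b) = a≢b (≤1-bad ¬ok-a ¬ok-b)
          both-bad (inj₁ ¬ok-a) (inj₂ (z , m , ¬ok-z)) with refl ← ≤1-bad ¬ok-a ¬ok-z = outside (sub₂ m) a∈B
          both-bad (inj₂ (z , m , ¬ok-z)) (inj₁ ¬ok-b) with refl ← ≤1-bad ¬ok-z ¬ok-b = outside (sub₁ m) b∈B
          both-bad (inj₂ (z₁ , m₁ , ¬ok₁)) (inj₂ (z₂ , m₂ , ¬ok₂)) with refl ← ≤1-bad ¬ok₁ ¬ok₂ =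
            ¬ok₁ (subst Ok (sym (meet m₁ m₂)) ok-s)

        connect : (∀ {h₁ h₂} → h₁ ∈ B → Ok h₁ → h₂ ∈ B → Ok h₂ → Walk (λ x → x ∈ B × Ok x) h₁ h₂) →
                  ∀ {s t} → s ∈ T → Ok s → t ∈ T → Ok t → Walk OkT s t
        connect within-B s∈T ok-s t∈T ok-t
          with h₁ , h₁∈B , ok₁ , s⇝h₁ ← reach-block s∈T ok-s
          with h₂ , h₂∈B , ok₂ , t⇝h₂ ← reach-block t∈T ok-t
          = s⇝h₁ ++ʷ Walk-map (map₁ B⊆T) (within-B h₁∈B ok₁ h₂∈B ok₂) ++ʷ Walk-reverse t⇝h₂

      T-connected : ConnectedOn G T
      T-connected u v u∈T v∈T =
        Walk⇒ReachIn (Walk-map proj₁ (connect within-B u∈T tt v∈T tt))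
        where
        open Avoiding (λ _ → ⊤) (λ _ → yes tt) (λ ¬⊤ _ → ⊥-elim (¬⊤ tt))
        within-B : ∀ {h₁ h₂} → h₁ ∈ B → ⊤ → h₂ ∈ B → ⊤ → Walk (λ x → x ∈ B × ⊤) h₁ h₂
        within-B h₁∈B _ h₂∈B _ =
          Walk-map (_, tt) (ReachIn⇒Walk (IsBlock⇒ConnectedOn B-block _ _ h₁∈B h₂∈B))

      T-minus-connected : ∀ z → z ∈ T → ConnectedOn G (T - z)
      T-minus-connected z _ u v u∈T-z v∈T-z =
        let u∈T , u≢z = x∈p-y⇒x∈p∧x≢y u∈T-z ; v∈T , v≢z = x∈p-y⇒x∈p∧x≢y v∈T-z in
        Walk⇒ReachIn (Walk-map (uncurry x∈p∧x≢y⇒x∈p-y) (connect within-B u∈T u≢z v∈T v≢z))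
        where
        only-z : ∀ {x y} → ¬ x ≢ z → ¬ y ≢ z → x ≡ y
        only-z {x} {y} x≡z y≡z = trans (decidable-stable (x ≟ z) x≡z) (sym (decidable-stable (y ≟ z) y≡z))
        open Avoiding (_≢ z) (λ x → ¬? (x ≟ z)) only-z
        within-B : ∀ {h₁ h₂} → h₁ ∈ B → h₁ ≢ z → h₂ ∈ B → h₂ ≢ z → Walk (λ x → x ∈ B × x ≢ z) h₁ h₂
        within-B h₁∈B h₁≢z h₂∈B h₂≢z with z ∈? B
        ... | yes z∈B = Walk-map x∈p-y⇒x∈p∧x≢y (ReachIn⇒Walk (IsBlock⇒ConnectedOn- B-block z z∈B _ _
                          (x∈p∧x≢y⇒x∈p-y h₁∈B h₁≢z) (x∈p∧x≢y⇒x∈p-y h₂∈B h₂≢z)))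
        ... | no z∉B = Walk-map (λ x∈B → x∈B , x∉p∧y∈p⇒x≢y z∉B x∈B ∘ sym)
                         (ReachIn⇒Walk (IsBlock⇒ConnectedOn B-block _ _ h₁∈B h₂∈B))

    ear-nonSeparable : NonSeparable G (B ∪ fromList (vertices w))
    ear-nonSeparable = (a , B⊆T a∈B) , T-connected , T-minus-connected

    no-ear : ⊥
    no-ear = Walk-start w (proj₂ B-block T B⊆T ear-nonSeparable (w⊆T (start∈vertices w)))

  -- Entry points

  EntryWalk-narrow : ∀ {S T y c} → S ⊆ T → EntryWalk T y c → EntryWalk S y c
  EntryWalk-narrow S⊆T = Walk-map [ (λ x∉T → inj₁ (x∉T ∘ S⊆T)) , inj₂ ]′

  SingleEntry : Subset n → Set
  SingleEntry S = ∀ {y a b} → y ∉ S → a ∈ S → b ∈ S → EntryWalk S y a → EntryWalk S y b → a ≡ b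

  IsBlock⇒SingleEntry : ∀ {B} → IsBlock G B → SingleEntry B
  IsBlock⇒SingleEntry B-block {y} {a} {b} y∉B a∈B b∈B y⇝a y⇝b with a ≟ b
  ... | yes a≡b = a≡b
  ... | no a≢b
    with c₁ , y⇝c₁ , c₁~a ← first-neighbour y⇝a (x∉p∧y∈p⇒x≢y y∉B a∈B)
    with c₂ , y⇝c₂ , c₂~b ← first-neighbour y⇝b (x∉p∧y∈p⇒x≢y y∉B b∈B)
    with w , w-simple , _ ← simplify (Walk-reverse y⇝c₁ ++ʷ y⇝c₂)
    = ⊥-elim (Ear.no-ear B-block a∈B b∈B a≢b (~-sym c₁~a) w w-simple c₂~b)

  -- A path from w to x inside B - u would enter S at a second point besides u.
  SingleEntry⇒block-meets-at : ∀ {S B u w} → SingleEntry S → u ∈ S → w ∉ S → u ~ w →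
                               IsBlock G B → u ∈ B → w ∈ B → ∀ {x} → x ∈ B → x ∈ S → x ≡ u
  SingleEntry⇒block-meets-at {S} {B} {u} {w} S-single u∈S w∉S u~w B-block u∈B w∈B {x} x∈B x∈S with x ≟ u
  ... | yes x≡u = x≡u
  ... | no x≢u =
    let x′ , x′∈S , x′∈B-u , w⇝x′ = first-entry (ReachIn⇒Walk w⇝x) w∉S x∈S
    in ⊥-elim (proj₂ (x∈p-y⇒x∈p∧x≢y x′∈B-u) (sym (S-single w∉S u∈S x′∈S w⇝u w⇝x′)))
    where
    w⇝x : ReachIn G (B - u) w x
    w⇝x = IsBlock⇒ConnectedOn- B-block u u∈B w x (x∈p∧x≢y⇒x∈p-y w∈B (x∉p∧y∈p⇒x≢y w∉S u∈S))
                                                  (x∈p∧x≢y⇒x∈p-y x∈B x≢u)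
    w⇝u : EntryWalk S w u
    w⇝u = inj₁ w∉S ∷⟨ ~-sym u~w ⟩ stop (inj₂ refl)

  module _ {S B u} (S-single : SingleEntry S) (B-block : IsBlock G B) (u∈S : u ∈ S) (u∈B : u ∈ B)
           (B∩S≡u : ∀ {x} → x ∈ B → x ∈ S → x ≡ u) where

    private
      reroute : ∀ {y b} → b ∈ B → b ∉ S → EntryWalk (S ∪ B) y b → EntryWalk S y u
      reroute b∈B b∉S y⇝b =
        Walk-map [ (λ x∉S∪B → inj₁ (x∉S∪B ∘ p⊆p∪q B)) , (λ { refl → inj₁ b∉S }) ]′ y⇝b
        ++ʷ Walk-map inside-B (ReachIn⇒Walk (IsBlock⇒ConnectedOn B-block _ _ b∈B u∈B))
        where
        inside-B : ∀ {x} → x ∈ B → x ∉ S ⊎ x ≡ u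
        inside-B {x} x∈B with x ∈? S
        ... | yes x∈S = inj₂ (B∩S≡u x∈B x∈S)
        ... | no x∉S = inj₁ x∉S

      B-single : ∀ {y a b} → y ∉ S ∪ B → EntryWalk (S ∪ B) y a → EntryWalk (S ∪ B) y b → a ∈ B → b ∈ B → a ≡ b
      B-single y∉ y⇝a y⇝b a∈B b∈B =
        IsBlock⇒SingleEntry B-block (y∉ ∘ B⊆) a∈B b∈B (EntryWalk-narrow B⊆ y⇝a) (EntryWalk-narrow B⊆ y⇝b)
        where
        B⊆ : B ⊆ S ∪ B
        B⊆ = q⊆p∪q S B

      -- Rerouting the walk to b through B makes u an entry point of S, so a = u.
      entry-in-B : ∀ {y a b} → y ∉ S ∪ B → a ∈ S → b ∈ S ∪ B → b ∉ S →
                   EntryWalk (S ∪ B) y a → EntryWalk (S ∪ B) y b → a ∈ B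
      entry-in-B {a = a} y∉ a∈S b∈ b∉S y⇝a y⇝b = subst (_∈ B) (sym a≡u) u∈B
        where
        a≡u : a ≡ u
        a≡u = S-single (y∉ ∘ p⊆p∪q B) a∈S u∈S (EntryWalk-narrow (p⊆p∪q B) y⇝a)
                       (reroute (x∈p∪q∧x∉p⇒x∈q b∈ b∉S) b∉S y⇝b)

    SingleEntry-∪ : SingleEntry (S ∪ B)
    SingleEntry-∪ {y} {a} {b} y∉ a∈ b∈ y⇝a y⇝b with a ∈? S | b ∈? S
    ... | yes a∈S | yes b∈S = S-single (y∉ ∘ S⊆) a∈S b∈S (EntryWalk-narrow S⊆ y⇝a) (EntryWalk-narrow S⊆ y⇝b)
      where
      S⊆ : S ⊆ S ∪ B
      S⊆ = p⊆p∪q B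
    ... | yes a∈S | no b∉S = B-single y∉ y⇝a y⇝b (entry-in-B y∉ a∈S b∈ b∉S y⇝a y⇝b) (x∈p∪q∧x∉p⇒x∈q b∈ b∉S)
    ... | no a∉S | yes b∈S = B-single y∉ y⇝a y⇝b (x∈p∪q∧x∉p⇒x∈q a∈ a∉S) (entry-in-B y∉ b∈S a∈ a∉S y⇝b y⇝a)
    ... | no a∉S | no b∉S = B-single y∉ y⇝a y⇝b (x∈p∪q∧x∉p⇒x∈q a∈ a∉S) (x∈p∪q∧x∉p⇒x∈q b∈ b∉S)

  AtMostTwoBlocks : Set
  AtMostTwoBlocks = ∀ v S₁ S₂ S₃ → IsBlock G S₁ → IsBlock G S₂ → IsBlock G S₃ →
                    v ∈ S₁ → v ∈ S₂ → v ∈ S₃ → S₁ ≡ S₂ ⊎ S₁ ≡ S₃ ⊎ S₂ ≡ S₃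

  neighbour∈blocks : AtMostTwoBlocks → ∀ {B₁ B₂ u w y} → IsBlock G B₁ → IsBlock G B₂ →
                     u ∈ B₁ → u ∈ B₂ → w ∈ B₂ → w ∉ B₁ → u ~ y → y ∈ B₁ ⊎ y ∈ B₂
  neighbour∈blocks ≤2 {B₁} {B₂} B₁-block B₂-block u∈B₁ u∈B₂ w∈B₂ w∉B₁ u~y
    with B , B-block , u∈B , y∈B ← edge-block u~y
    with ≤2 _ B B₁ B₂ B-block B₁-block B₂-block u∈B u∈B₁ u∈B₂
  ... | inj₁ refl = inj₁ y∈B
  ... | inj₂ (inj₁ refl) = inj₂ y∈B
  ... | inj₂ (inj₂ refl) = ⊥-elim (w∉B₁ w∈B₂)

  BoundaryEdge : Subset n → Set
  BoundaryEdge S = ∃ λ u → u ∈ S × ∃ λ w → w ∉ S × u ~ w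

  BoundaryEdge-dec : ∀ S → Dec (BoundaryEdge S)
  BoundaryEdge-dec S = Fin.any? λ u → (u ∈? S) ×-dec Fin.any? λ w → ¬? (w ∈? S) ×-dec (u ~? w)

  no-boundary⇒full : Connected G → ∀ {S} → ¬ BoundaryEdge S → ∃ (_∈ S) → ∀ x → x ∈ S
  no-boundary⇒full (_ , connected) {S} no-boundary (v , v∈S) x = walk-in (connected v x) v∈S
    where
    walk-in : ∀ {p q} → ReachIn G Subset.⊤ p q → p ∈ S → q ∈ S
    walk-in (here _) p∈S = p∈S
    walk-in (step {w = z} _ p~z r) p∈S with z ∈? S
    ... | yes z∈S = walk-in r z∈S
    ... | no z∉S = ⊥-elim (no-boundary (_ , p∈S , z , z∉S , p~z))

  -- Prism paths through a block

  infix 4 _~□_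
  _~□_ : V × Bool → V × Bool → Set
  _~□_ = PrismAdj G

  rung : ∀ v a → (v , a) ~□ (v , not a)
  rung v a = inj₂ (refl , Bool.not-¬ refl)

  zigzag : Bool → List V → List (V × Bool)
  zigzag a [] = []
  zigzag a (v ∷ vs) = (v , a) ∷ (v , not a) ∷ zigzag (not a) vs

  zigzag-linked : ∀ x vs y a → Linked _~_ (x ∷ vs ∷ʳ y) →
                  Linked _~□_ ((x , a) ∷ zigzag a vs ∷ʳ (y , notⁿ (length vs) a))
  zigzag-linked x [] y a (e ∷ [-]) = inj₁ (refl , e) ∷ [-]
  zigzag-linked x (v ∷ vs) y a (e ∷ l) = inj₁ (refl , e) ∷ rung v a ∷ zigzag-linked v vs y (not a) l

  ∈-zigzag⁻ : ∀ {x b} a vs → (x , b) ∈ₗ zigzag a vs → x ∈ₗ vs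
  ∈-zigzag⁻ a (v ∷ vs) (here refl) = here refl
  ∈-zigzag⁻ a (v ∷ vs) (there (here refl)) = here refl
  ∈-zigzag⁻ a (v ∷ vs) (there (there m)) = there (∈-zigzag⁻ (not a) vs m)

  ∈-zigzag⁺ : ∀ {x} b a vs → x ∈ₗ vs → (x , b) ∈ₗ zigzag a vs
  ∈-zigzag⁺ false false (v ∷ vs) (here refl) = here refl
  ∈-zigzag⁺ true true (v ∷ vs) (here refl) = here refl
  ∈-zigzag⁺ false true (v ∷ vs) (here refl) = there (here refl)
  ∈-zigzag⁺ true false (v ∷ vs) (here refl) = there (here refl)
  ∈-zigzag⁺ b a (v ∷ vs) (there m) = there (there (∈-zigzag⁺ b (not a) vs m))

  zigzag-unique : ∀ a vs → Unique vs → Unique (zigzag a vs)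
  zigzag-unique a [] _ = []
  zigzag-unique a (v ∷ vs) (v∉vs ∷ u) =
    ((Bool.not-¬ refl ∘ cong proj₂) ∷ v∉zigzag) ∷ v∉zigzag ∷ zigzag-unique (not a) vs u
    where
    v∉zigzag : ∀ {b} → All ((v , b) ≢_) (zigzag (not a) vs)
    v∉zigzag = ¬Any⇒All¬ _ (All¬⇒¬Any v∉vs ∘ ∈-zigzag⁻ _ vs)

  zigzag-rung : ∀ {x} a vs → x ∈ₗ vs → ∃ λ b → Consecutive (x , b) (x , not b) (zigzag a vs)
  zigzag-rung a (v ∷ vs) (here refl) = a , here
  zigzag-rung a (v ∷ vs) (there m) with b , c ← zigzag-rung (not a) vs m = b , there (there c)

  record CyclicOrder (B : Subset n) : Set where
    field
      order    : List V
      unique   : Unique order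
      sound    : ∀ {x} → x ∈ₗ order → x ∈ B
      complete : ∀ {x} → x ∈ B → x ∈ₗ order
      linked   : CyclicallyLinked _~_ order
      k        : ℕ
      length≡  : length order ≡ suc (suc (k * 2))

  IsEdgeOn⇒CyclicOrder : ∀ {B} → IsEdgeOn G B → CyclicOrder B
  IsEdgeOn⇒CyclicOrder (u , v , u≢v , u~v , cover , u∈B , v∈B) = record
    { order = u ∷ v ∷ []
    ; unique = (u≢v ∷ []) ∷ [] ∷ []
    ; sound = λ { (here refl) → u∈B ; (there (here refl)) → v∈B }
    ; complete = λ x∈B → [ here , (λ x≡v → there (here x≡v)) ]′ (cover _ x∈B)
    ; linked = u~v ∷ ~-sym u~v ∷ [-]
    ; k = 0
    ; length≡ = refl
    }

  IsEvenCycleOn⇒CyclicOrder : ∀ {B} → IsEvenCycleOn G B → CyclicOrder B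
  IsEvenCycleOn⇒CyclicOrder {B} (k , f , f-injective , cover , f∈B , adjacent) = record
    { order = List.tabulate f
    ; unique = Unique.tabulate⁺ f-injective
    ; sound = λ m → let i , e = ∈-tabulate⁻ {f = f} m in subst (_∈ B) (sym e) (f∈B i)
    ; complete = λ x∈B → let i , e = cover _ x∈B in subst (_∈ₗ List.tabulate f) e (∈-tabulate⁺ {f = f} i)
    ; linked = Linked-tabulate f (f Fin.zero) next wrap
    ; k = suc k
    ; length≡ = List.length-tabulate f
    }
    where
    L : ℕ
    L = suc (suc (suc (suc (k * 2))))
    successor : ∀ i j → toℕ j ≡ suc (toℕ i) % L → f i ~ f j
    successor i j e = proj₂ (adjacent i j) (inj₁ (Fin.toℕ-injective (trans e (sym (Fin.toℕ-fromℕ< _)))))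
    next : ∀ i → f (Fin.inject₁ i) ~ f (Fin.suc i)
    next i = successor _ _ (sym (trans (cong (λ t → suc t % L) (Fin.toℕ-inject₁ i))
                                       (m<n⇒m%n≡m (s≤s (Fin.toℕ<n i)))))
    wrap : f (Fin.fromℕ (suc (suc (suc (k * 2))))) ~ f Fin.zero
    wrap = successor _ _ (sym (trans (cong (λ t → suc t % L) (Fin.toℕ-fromℕ (suc (suc (suc (k * 2))))))
                                     (n%n≡0 L)))

  record RootedCycle (B : Subset n) (u : V) : Set where
    field
      inner    : List V
      unique   : Unique inner
      sound    : ∀ {x} → x ∈ₗ inner → x ∈ B × x ≢ u
      complete : ∀ {x} → x ∈ B → x ≢ u → x ∈ₗ inner
      linked   : Linked _~_ (u ∷ inner ∷ʳ u)
      k        : ℕ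
      length≡  : length inner ≡ suc (k * 2)

  CyclicOrder-rotate : ∀ {B u} → CyclicOrder B → u ∈ B → RootedCycle B u
  CyclicOrder-rotate {B} {u} c u∈B with xs , ys , split ← ∈-∃++ (CyclicOrder.complete c u∈B) = record
    { inner = ys ++ xs
    ; unique = rotated-unique .proj₂
    ; sound = λ m → sound (∈-resp-↭ (↭-sym rotation) (there m)) ,
                    λ { refl → All¬⇒¬Any (rotated-unique .proj₁) m }
    ; complete = λ x∈B x≢u → inner-complete (∈-resp-↭ rotation (complete x∈B)) x≢u
    ; linked = CyclicallyLinked-rotate xs u ys (subst (CyclicallyLinked _~_) split linked)
    ; k = k
    ; length≡ = ℕ.suc-injective (trans (sym (↭-length rotation)) length≡)
    }
    where
    open CyclicOrder c
    rotation : order ↭ u ∷ ys ++ xs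
    rotation = subst (_↭ _) (sym split) (↭-trans (shift u xs ys) (prep u (++-comm xs ys)))
    rotated-unique : All (u ≢_) (ys ++ xs) × Unique (ys ++ xs)
    rotated-unique with u∉ ∷ uniq ← Unique-resp-↭ rotation unique = u∉ , uniq
    inner-complete : ∀ {x} → x ∈ₗ u ∷ ys ++ xs → x ≢ u → x ∈ₗ ys ++ xs
    inner-complete (here x≡u) x≢u = ⊥-elim (x≢u x≡u)
    inner-complete (there m) _ = m

  record Detour (B : Subset n) (u : V) (a : Bool) : Set where
    field
      path     : List (V × Bool)
      linked   : Linked _~□_ ((u , a) ∷ path ∷ʳ (u , not a))
      unique   : Unique path
      sound    : ∀ {x b} → (x , b) ∈ₗ path → x ∈ B × x ≢ u
      complete : ∀ {x} b → x ∈ B → x ≢ u → (x , b) ∈ₗ path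
      rungs    : ∀ {x} → x ∈ B → x ≢ u → ∃ λ b → Consecutive (x , b) (x , not b) path
      nonempty : 1 ≤ length path

  -- The closed walk through B has odd inner length, so the zigzag ends on the opposite layer.
  RootedCycle⇒Detour : ∀ {B u} → RootedCycle B u → ∀ a → Detour B u a
  RootedCycle⇒Detour {B} {u} r a = record
    { path = zigzag a inner
    ; linked = subst (λ b → Linked _~□_ ((u , a) ∷ zigzag a inner ∷ʳ (u , b))) lands-opposite
                     (zigzag-linked u inner u a linked)
    ; unique = zigzag-unique a inner unique
    ; sound = sound ∘ ∈-zigzag⁻ a inner
    ; complete = λ b x∈B x≢u → ∈-zigzag⁺ b a inner (complete x∈B x≢u)
    ; rungs = λ x∈B x≢u → zigzag-rung a inner (complete x∈B x≢u)
    ; nonempty = nonempty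
    }
    where
    open RootedCycle r
    lands-opposite : notⁿ (length inner) a ≡ not a
    lands-opposite = trans (cong (λ m → notⁿ m a) length≡) (notⁿ-odd k a)
    nonempty : 1 ≤ length (zigzag a inner)
    nonempty with inner | length≡
    ... | _ ∷ _ | _ = s≤s z≤n

  -- Growing the prism cycle

  -- Boundary rungs are where the detours through newly attached blocks get spliced in.
  record PrismCycle (S : Subset n) : Set where
    field
      cycle    : List (V × Bool)
      unique   : Unique cycle
      sound    : ∀ {x b} → (x , b) ∈ₗ cycle → x ∈ S
      complete : ∀ {x} b → x ∈ S → (x , b) ∈ₗ cycle
      closed   : CyclicallyLinked _~□_ cycle
      long     : 3 ≤ length cycle
      rungs    : ∀ {x y} → x ∈ S → x ~ y → y ∉ S → ∃ λ b → Consecutive (x , b) (x , not b) cycle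

  Detour⇒PrismCycle : ∀ {B u} → u ∈ B → Detour B u true → PrismCycle B
  Detour⇒PrismCycle {B} {u} u∈B D = record
    { cycle = (u , false) ∷ (u , true) ∷ path
    ; unique = ((Bool.not-¬ refl ∘ cong proj₂) ∷ u∉path) ∷ u∉path ∷ unique
    ; sound = λ { (here refl) → u∈B ; (there (here refl)) → u∈B ; (there (there m)) → proj₁ (sound m) }
    ; complete = complete′
    ; closed = rung u false ∷ linked
    ; long = s≤s (s≤s nonempty)
    ; rungs = λ {x} x∈B _ _ → rungs′ x∈B
    }
    where
    open Detour D
    u∉path : ∀ {b} → All ((u , b) ≢_) path
    u∉path = ¬Any⇒All¬ _ λ m → proj₂ (sound m) refl
    complete′ : ∀ {x} b → x ∈ B → (x , b) ∈ₗ (u , false) ∷ (u , true) ∷ path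
    complete′ {x} b x∈B with x ≟ u
    ... | no x≢u = there (there (complete b x∈B x≢u))
    complete′ false _ | yes refl = here refl
    complete′ true _ | yes refl = there (here refl)
    rungs′ : ∀ {x} → x ∈ B → ∃ λ b → Consecutive (x , b) (x , not b) ((u , false) ∷ (u , true) ∷ path)
    rungs′ {x} x∈B with x ≟ u
    ... | yes refl = false , here
    ... | no x≢u with b , c ← rungs x∈B x≢u = b , there (there c)

  module Splice {S B u} (C : PrismCycle S) (u∈S : u ∈ S) {a}
                (u-rung : Consecutive (u , a) (u , not a) (PrismCycle.cycle C)) (D : Detour B u a)
                (B∩S≡u : ∀ {x} → x ∈ B → x ∈ S → x ≡ u) (u-interior : ∀ {y} → u ~ y → y ∈ S ∪ B) where

    private
      open PrismCycle C
      module D = Detour D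

      split : ∃₂ λ xs ys → cycle ≡ xs ++ (u , a) ∷ (u , not a) ∷ ys
      split = Consecutive⇒∃++ u-rung

      xs ys : List (V × Bool)
      xs = proj₁ split
      ys = proj₁ (proj₂ split)

      cycle≡ : cycle ≡ xs ++ (u , a) ∷ (u , not a) ∷ ys
      cycle≡ = proj₂ (proj₂ split)

      cycle′ : List (V × Bool)
      cycle′ = xs ++ (u , a) ∷ D.path ++ (u , not a) ∷ ys

      cycle′↭ : cycle′ ↭ D.path ++ cycle
      cycle′↭ = subst (λ c → cycle′ ↭ D.path ++ c) (sym cycle≡) (
        subst₂ _↭_ (List.++-assoc xs ((u , a) ∷ []) (D.path ++ (u , not a) ∷ ys))
                   (cong (D.path ++_) (List.++-assoc xs ((u , a) ∷ []) ((u , not a) ∷ ys)))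
                   (shifts (xs ∷ʳ (u , a)) D.path))

      ∈-cycle′⁻ : ∀ {p} → p ∈ₗ cycle′ → p ∈ₗ D.path ⊎ p ∈ₗ cycle
      ∈-cycle′⁻ = ∈-++⁻ D.path ∘ ∈-resp-↭ cycle′↭

      ∈-cycle′⁺ : ∀ {p} → p ∈ₗ D.path ⊎ p ∈ₗ cycle → p ∈ₗ cycle′
      ∈-cycle′⁺ = ∈-resp-↭ (↭-sym cycle′↭) ∘ [ ∈-++⁺ˡ , ∈-++⁺ʳ D.path ]′

      S⊆S∪B : S ⊆ S ∪ B
      S⊆S∪B = p⊆p∪q B

      B⊆S∪B : B ⊆ S ∪ B
      B⊆S∪B = q⊆p∪q S B

      unique′ : Unique cycle′
      unique′ = Unique-resp-↭ (↭-sym cycle′↭) (Unique.++⁺ D.unique unique disjoint)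
        where
        disjoint : ∀ {p} → ¬ (p ∈ₗ D.path × p ∈ₗ cycle)
        disjoint (m₁ , m₂) = let x∈B , x≢u = D.sound m₁ in x≢u (B∩S≡u x∈B (sound m₂))

      sound′ : ∀ {x b} → (x , b) ∈ₗ cycle′ → x ∈ S ∪ B
      sound′ = [ B⊆S∪B ∘ proj₁ ∘ D.sound , S⊆S∪B ∘ sound ]′ ∘ ∈-cycle′⁻

      complete′ : ∀ {x} b → x ∈ S ∪ B → (x , b) ∈ₗ cycle′
      complete′ {x} b x∈S∪B with x∈p∪q⁻ S B x∈S∪B | x ≟ u
      ... | inj₁ x∈S | _ = ∈-cycle′⁺ (inj₂ (complete b x∈S))
      ... | inj₂ _ | yes refl = ∈-cycle′⁺ (inj₂ (complete b u∈S))
      ... | inj₂ x∈B | no x≢u = ∈-cycle′⁺ (inj₁ (D.complete b x∈B x≢u))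

      closed′ : CyclicallyLinked _~□_ cycle′
      closed′ = CyclicallyLinked-insert xs (u , a) (u , not a) ys D.path
                  (subst (CyclicallyLinked _~□_) cycle≡ closed) D.linked

      long′ : 3 ≤ length cycle′
      long′ = ℕ.≤-trans (s≤s (s≤s D.nonempty)) (length-insert xs (u , a) D.path (u , not a) ys)

      rungs′ : ∀ {x y} → x ∈ S ∪ B → x ~ y → y ∉ S ∪ B → ∃ λ b → Consecutive (x , b) (x , not b) cycle′
      rungs′ {x} x∈S∪B x~y y∉S∪B with x ∈? S
      ... | yes x∈S with x ≟ u
      ...   | yes refl = ⊥-elim (y∉S∪B (u-interior x~y))
      ...   | no x≢u with b , c ← rungs x∈S x~y (y∉S∪B ∘ S⊆S∪B) =
              b , Consecutive-insert xs D.path (subst (Consecutive _ _) cycle≡ c) off-u off-u off-u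
        where
        off-u : ∀ {b c} → (x , b) ≢ (u , c)
        off-u = x≢u ∘ cong proj₁
      rungs′ {x} x∈S∪B x~y y∉S∪B | no x∉S
        with b , c ← D.rungs (x∈p∪q∧x∉p⇒x∈q x∈S∪B x∉S) (x∉p∧y∈p⇒x≢y x∉S u∈S)
        = b , Consecutive-++⁺ʳ xs (there (Consecutive-++⁺ˡ _ c))

    PrismCycle-splice : PrismCycle (S ∪ B)
    PrismCycle-splice = record
      { cycle = cycle′ ; unique = unique′ ; sound = sound′ ; complete = complete′
      ; closed = closed′ ; long = long′ ; rungs = rungs′ }

  PrismCycle-nonempty : ∀ {S} → PrismCycle S → ∃ (_∈ S)
  PrismCycle-nonempty C with PrismCycle.cycle C | PrismCycle.sound C | PrismCycle.long C
  ... | (x , _) ∷ _ | sound | _ = x , sound (here refl)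

  PrismCycle⇒PrismHamiltonian : ∀ {S} → PrismCycle S → (∀ x → x ∈ S) → PrismHamiltonian G
  PrismCycle⇒PrismHamiltonian C spanning =
    CyclicallyLinked⇒HamiltonianCycle cycle unique (λ (x , b) → complete b (spanning x)) closed long
    where open PrismCycle C

  record Stage (S : Subset n) : Set where
    field
      prismCycle   : PrismCycle S
      blockwise    : ∀ {x} → x ∈ S → ∃ λ B → IsBlock G B × B ⊆ S × x ∈ B
      single-entry : SingleEntry S

  module _ (sbep : IsSBEP G) where

    private
      connected : Connected G
      connected = proj₁ sbep

      cycle-or-edge : ∀ B → IsBlock G B → IsEvenCycleOn G B ⊎ IsEdgeOn G B
      cycle-or-edge = proj₁ (proj₂ sbep)

      at-most-two : AtMostTwoBlocks
      at-most-two = proj₂ (proj₂ sbep)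

    detour : ∀ {B u} → IsBlock G B → u ∈ B → ∀ a → Detour B u a
    detour {B} B-block u∈B = RootedCycle⇒Detour (CyclicOrder-rotate order u∈B)
      where
      order : CyclicOrder B
      order = [ IsEvenCycleOn⇒CyclicOrder , IsEdgeOn⇒CyclicOrder ]′ (cycle-or-edge B B-block)

    initial-stage : ∃ Stage
    initial-stage =
      let B , B-block , v∈B = vertex-block (proj₁ connected) in
      B , record { prismCycle = Detour⇒PrismCycle v∈B (detour B-block v∈B true)
                 ; blockwise = λ x∈B → B , B-block , id , x∈B
                 ; single-entry = IsBlock⇒SingleEntry B-block }

    Stage-extend : ∀ {S u w} → Stage S → u ∈ S → w ∉ S → u ~ w → ∃ λ S′ → S ⊂ S′ × Stage S′
    Stage-extend {S} {u} {w} stage u∈S w∉S u~w =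
      let B , B-block , u∈B , w∈B = edge-block u~w
          B∩S≡u = SingleEntry⇒block-meets-at single-entry u∈S w∉S u~w B-block u∈B w∈B
          a , u-rung = PrismCycle.rungs prismCycle u∈S u~w w∉S
      in S ∪ B , (p⊆p∪q B , w , x∈p∪q⁺ (inj₂ w∈B) , w∉S) , record
        { prismCycle = Splice.PrismCycle-splice prismCycle u∈S u-rung (detour B-block u∈B a) B∩S≡u
                                                (u-interior B-block u∈B w∈B)
        ; blockwise = [ blockwise-∪ ∘ blockwise , (λ x∈B → B , B-block , q⊆p∪q S B , x∈B) ]′ ∘ x∈p∪q⁻ S B
        ; single-entry = SingleEntry-∪ single-entry B-block u∈S u∈B B∩S≡u
        }
      where
      open Stage stage
      blockwise-∪ : ∀ {B′ x} → (∃ λ B → IsBlock G B × B ⊆ S × x ∈ B) →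
                    ∃ λ B → IsBlock G B × B ⊆ S ∪ B′ × x ∈ B
      blockwise-∪ (B , B-block , B⊆S , x∈B) = B , B-block , p⊆p∪q _ ∘ B⊆S , x∈B
      u-interior : ∀ {B} → IsBlock G B → u ∈ B → w ∈ B → ∀ {y} → u ~ y → y ∈ S ∪ B
      u-interior B-block u∈B w∈B u~y =
        let Bᵤ , Bᵤ-block , Bᵤ⊆S , u∈Bᵤ = blockwise u∈S in
        x∈p∪q⁺ (Sum.map₁ Bᵤ⊆S (neighbour∈blocks at-most-two Bᵤ-block B-block u∈Bᵤ u∈B w∈B (w∉S ∘ Bᵤ⊆S) u~y))

    Stage-grow : ∀ {S} → Stage S → (∃ λ S′ → S ⊂ S′ × Stage S′) ⊎ (∀ x → x ∈ S)
    Stage-grow {S} stage with BoundaryEdge-dec S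
    ... | yes (u , u∈S , w , w∉S , u~w) = inj₁ (Stage-extend stage u∈S w∉S u~w)
    ... | no no-boundary =
      inj₂ (no-boundary⇒full connected no-boundary (PrismCycle-nonempty (Stage.prismCycle stage)))

theorem2p3 : (G : Graph) → IsSBEP G → PrismHamiltonian G
theorem2p3 G sbep =
  let _ , stage , spanning = saturate (Stage-grow G sbep) (proj₂ (initial-stage G sbep))
  in PrismCycle⇒PrismHamiltonian G (Stage.prismCycle stage) spanning
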